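{- Let $t\ge 2$ and $m\ge 1$ be integers. Let $S^-_{m,t}$ be the set of $(t,mt-1)$-core partitions with distinct parts, and let $\mathcal{C}^-_{m,t}$ be the set of all sequences $(x_1,\ldots,x_{t-1})\in\mathbb{N}^{t-1}$ with $0\le x_i\le m$ for $1\le i\le t-2$, $x_ix_{i+1}=0$ for $1\le i\le t-2$, and $0\le x_{t-1}\le m-1$. Then the map $\varphi(\lambda)=(n_1(\lambda),n_2(\lambda),\ldots,n_{t-1}(\lambda))$ is a bijection from $S^-_{m,t}$ to $\mathcal{C}^-_{m,t}$.
   Context: A partition is a finite weakly decreasing sequence $\lambda=(\lambda_1,\ldots,\lambda_\ell)$ of positive integers; it has distinct parts if $\lambda_1>\cdots>\lambda_\ell$. The hook length of box $(i,j)$ of the Young diagram is the number of boxes directly to its right, directly below it, plus the box itself; $\lambda$ is an $s$-core if no hook length is divisible by $s$, and a $(t_1,t_2)$-core if it is both a $t_1$-core and a $t_2$-core. The $\beta$-set of $\lambda$ is $\beta(\lambda)=\{\lambda_i+\ell-i:1\le i\le \ell\}$. For $1\le i\le t-1$, $n_i(\lambda)$ denotes the number of integers $x\in\beta(\lambda)$ with $x\equiv i\pmod t$. $\mathbb{N}$ includes $0$. -}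

module Defs where

open import Data.Nat using (ℕ; zero; suc; _+_; _*_; _∸_; _≤_; _<_; _>_; _≥_; _<?_)
open import Data.Nat.Properties using (_≟_)
open import Data.Nat.DivMod using (_%_)
open import Data.Nat.Divisibility using (_∣_)
open import Data.List using (List; []; _∷_; length; filter; map; upTo; downFrom; zipWith; _++_)
open import Data.List.Relation.Unary.All using (All)
open import Data.List.Relation.Unary.Linked using (Linked)
open import Data.Product using (_×_)
open import Relation.Nullary using (¬_)

IsPartition : List ℕ → Set
IsPartition xs = All (λ x → 0 < x) xs × Linked _≥_ xs

DistinctParts : List ℕ → Set
DistinctParts xs = Linked _>_ xs

-- length of column j (0-indexed): number of rows with λ_k > j
colLen : List ℕ → ℕ → ℕ
colLen la j = length (filter (λ r → j <? r) la)

-- hook lengths of row i (0-indexed) of length r, columns j = 0 .. r-1: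
-- arm = r - (j+1), leg = colLen j - (i+1), hook = arm + leg + 1
hooksRow : List ℕ → ℕ → ℕ → List ℕ
hooksRow la i r = map (λ j → (r ∸ suc j) + (colLen la j ∸ suc i) + 1) (upTo r)

hooksFrom : List ℕ → ℕ → List ℕ → List ℕ
hooksFrom la i [] = []
hooksFrom la i (r ∷ rs) = hooksRow la i r ++ hooksFrom la (suc i) rs

hooks : List ℕ → List ℕ
hooks la = hooksFrom la 0 la

IsCore : ℕ → List ℕ → Set
IsCore s la = All (λ h → ¬ (s ∣ h)) (hooks la)

-- β-set: { λ_i + ℓ - i : 1 ≤ i ≤ ℓ }  (downFrom ℓ = [ℓ-1, ..., 0])
beta : List ℕ → List ℕ
beta la = zipWith _+_ la (downFrom (length la))

-- x mod t (only used with t ≥ 2)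
modℕ : ℕ → ℕ → ℕ
modℕ x zero = x
modℕ x (suc n) = x % suc n

nCount : ℕ → ℕ → List ℕ → ℕ
nCount t i la = length (filter (λ x → modℕ x t ≟ i) (beta la))

phi : ℕ → List ℕ → List ℕ
phi t la = map (λ i → nCount t (suc i) la) (upTo (t ∸ 1))

InS : ℕ → ℕ → List ℕ → Set
InS m t la = IsPartition la × DistinctParts la × IsCore t la × IsCore (m * t ∸ 1) la

-- 0-indexed list access (default 0 out of range; only used in range)
at : List ℕ → ℕ → ℕ
at [] i = 0
at (x ∷ xs) zero = x
at (x ∷ xs) (suc i) = at xs i

-- C⁻_{m,t}: xs = (x_1,...,x_{t-1}) with x_{k+1} = at xs k;
-- x_i ≤ m and x_i x_{i+1} = 0 for 1 ≤ i ≤ t-2, x_{t-1} ≤ m-1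
InC : ℕ → ℕ → List ℕ → Set
InC m t xs =
  length xs ≡' (t ∸ 1)
  × (∀ k → k + 2 < t → at xs k ≤ m)
  × (∀ k → k + 2 < t → at xs k * at xs (suc k) ≡' 0)
  × at xs (t ∸ 2) ≤ m ∸ 1
  where
  open import Relation.Binary.PropositionalEquality using () renaming (_≡_ to _≡'_)

module Submission where

-- The proof works entirely with β-sets (the abacus picture).
--  * Hooks versus β-sets: the hook lengths of λ are exactly the differences
--    x - y with x ∈ β(λ), y ∉ β(λ), y < x.  Hence λ is an s-core iff β(λ) is
--    closed under x ↦ x - s (core⇒closed, closed⇒core).
--  * Partitions with distinct parts correspond, via β and its inverse
--    fromBeta, to strictly decreasing lists without 0 whose entries are
--    pairwise non-consecutive ("apart").
--  * Residue classes: in a strictly decreasing t-closed list B the members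
--    congruent to i mod t are exactly i, i+t, …, i+(c-1)t, c being their
--    number (quotients-downFrom).  So B is determined by its residue counts.
--  * In module CoreProfiles the β-sets of S⁻_{m,t} are axiomatised as the
--    Admissible sets; their count vectors ("profiles") lie in C⁻_{m,t}
--    (Counts), determine the set (profile-injective), and every vector of
--    C⁻_{m,t} is the profile of an explicit admissible set (Realisation).
-- The theorem follows by transporting these facts along λ ↦ β(λ).

open import Defs
open import Data.Nat
open import Data.Nat.Properties
open import Data.Nat.DivMod
open import Data.Nat.Divisibility using (_∣_; divides; ∣-refl)
open import Data.Nat.Tactic.RingSolver using (solve-∀)
open import Data.List
open import Data.List.Properties
open import Data.List.Membership.Propositional using (_∈_; _∉_)
open import Data.List.Membership.Propositional.Properties
open import Data.List.Relation.Unary.Any using (here; there)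
open import Data.List.Relation.Unary.All as All using (All; []; _∷_)
import Data.List.Relation.Unary.AllPairs as AllPairs
open import Data.List.Relation.Unary.Linked as Linked using (Linked; []; [-]; _∷_)
import Data.List.Relation.Unary.Linked.Properties as Linkedₚ
open import Data.Product using (_×_; Σ; _,_; proj₁; proj₂)
open import Data.Sum using (inj₁; inj₂; [_,_]′)
open import Data.Empty using (⊥; ⊥-elim)
open import Relation.Nullary using (¬_; Dec; yes; no)
open import Relation.Nullary.Decidable using (_×-dec_)
open import Relation.Binary using (tri<; tri≈; tri>)
open import Relation.Binary.PropositionalEquality
open import Function using (_∘_; id)

head-above : ∀ {a xs} → Linked _>_ (a ∷ xs) → All (_< a) xs
head-above = AllPairs.head ∘ Linkedₚ.Linked⇒AllPairs {R = _>_} (λ p q → <-trans q p)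

head-bounds : ∀ {a xs} → Linked _≥_ (a ∷ xs) → All (_≤ a) xs
head-bounds = AllPairs.head ∘ Linkedₚ.Linked⇒AllPairs {R = _≥_} (λ p q → ≤-trans q p)

decreasing-ext : ∀ {A C} → Linked _>_ A → Linked _>_ C →
                 (∀ {x} → x ∈ A → x ∈ C) → (∀ {x} → x ∈ C → x ∈ A) → A ≡ C
decreasing-ext {[]} {[]} _ _ _ _ = refl
decreasing-ext {[]} {c ∷ C} _ _ _ g with () ← g (here refl)
decreasing-ext {a ∷ A} {[]} _ _ f _ with () ← f (here refl)
decreasing-ext {a ∷ A} {c ∷ C} la lc f g =
  cong₂ _∷_ a≡c (decreasing-ext (Linked.tail la) (Linked.tail lc) (below f a≡c la) (below g (sym a≡c) lc))
  where
  a≡c : a ≡ c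
  a≡c with f (here refl) | g (here refl)
  ... | here e  | _       = e
  ... | there _ | here e  = sym e
  ... | there p | there q =
    ⊥-elim (<-asym (All.lookup (head-above lc) p) (All.lookup (head-above la) q))
  below : ∀ {a c A C} → (∀ {x} → x ∈ a ∷ A → x ∈ c ∷ C) → a ≡ c → Linked _>_ (a ∷ A) →
          ∀ {x} → x ∈ A → x ∈ C
  below f refl la x∈ with f (there x∈)
  ... | here e  = ⊥-elim (<⇒≢ (All.lookup (head-above la) x∈) e)
  ... | there p = p

∈-tail : ∀ {a K x} → Linked _>_ (a ∷ K) → x ∈ a ∷ K → x < a → x ∈ K
∈-tail _ (here refl) x<a = ⊥-elim (<-irrefl refl x<a)
∈-tail _ (there p)   _   = p

predClosed⇒downFrom : ∀ {K} → Linked _>_ K → (∀ {k} → suc k ∈ K → k ∈ K) → K ≡ downFrom (length K)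
predClosed⇒downFrom {[]} _ _ = refl
predClosed⇒downFrom {a ∷ K} lk closed = cong₂ _∷_ (≤-antisym a≤n n≤a) tail≡
  where
  n = length K
  below-a : ∀ {x} → x ∈ K → x < a
  below-a = All.lookup (head-above lk)
  tail≡ : K ≡ downFrom n
  tail≡ = predClosed⇒downFrom (Linked.tail lk)
            (λ sk∈ → ∈-tail lk (closed (there sk∈)) (<-trans (n<1+n _) (below-a sk∈)))
  -- every entry of downFrom n lies below a
  n≤a : n ≤ a
  n≤a with n | tail≡
  ... | zero  | _ = z≤n
  ... | suc p | e = below-a (subst (p ∈_) (sym e) (∈-downFrom⁺ (n<1+n p)))
  -- the predecessor of a is in K = downFrom n
  a≤n : a ≤ n
  a≤n = head≤n lk closed
    where
    head≤n : ∀ {b} → Linked _>_ (b ∷ K) → (∀ {k} → suc k ∈ b ∷ K → k ∈ b ∷ K) → b ≤ n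
    head≤n {zero}  _   _  = z≤n
    head≤n {suc b} lk' cl = ∈-downFrom⁻ (subst (b ∈_) tail≡ (∈-tail lk' (cl (here refl)) (n<1+n b)))

map-upTo-cong : ∀ n (f g : ℕ → ℕ) → (∀ j → j < n → f j ≡ g j) → map f (upTo n) ≡ map g (upTo n)
map-upTo-cong n f g f≗g = trans (map-upTo f n) (trans (applyUpTo-cong n f g f≗g) (sym (map-upTo g n)))
  where
  applyUpTo-cong : ∀ n (f g : ℕ → ℕ) → (∀ j → j < n → f j ≡ g j) → applyUpTo f n ≡ applyUpTo g n
  applyUpTo-cong zero    f g _   = refl
  applyUpTo-cong (suc n) f g f≗g =
    cong₂ _∷_ (f≗g 0 z<s) (applyUpTo-cong n (f ∘ suc) (g ∘ suc) (λ j j<n → f≗g (suc j) (s<s j<n)))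

at-map-upTo : ∀ (f : ℕ → ℕ) n k → k < n → at (map f (upTo n)) k ≡ f k
at-map-upTo f n k k<n = trans (cong (λ l → at l k) (map-upTo f n)) (at-applyUpTo f n k k<n)
  where
  at-applyUpTo : ∀ (f : ℕ → ℕ) n k → k < n → at (applyUpTo f n) k ≡ f k
  at-applyUpTo f (suc n) zero    _         = refl
  at-applyUpTo f (suc n) (suc k) (s<s k<n) = at-applyUpTo (f ∘ suc) n k k<n

map-upTo-at : ∀ (f : ℕ → ℕ) xs n → length xs ≡ n → (∀ j → j < n → f j ≡ at xs j) → map f (upTo n) ≡ xs
map-upTo-at f xs n refl f≗xs = trans (map-upTo f (length xs)) (applyUpTo-at f xs f≗xs)
  where
  applyUpTo-at : ∀ (f : ℕ → ℕ) xs → (∀ j → j < length xs → f j ≡ at xs j) → applyUpTo f (length xs) ≡ xs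
  applyUpTo-at f []       _    = refl
  applyUpTo-at f (x ∷ xs) f≗xs = cong₂ _∷_ (f≗xs 0 z<s) (applyUpTo-at (f ∘ suc) xs (λ j j< → f≗xs (suc j) (s<s j<)))

≡-from-below : ∀ a b → (∀ k → k < a → k < b) → (∀ k → k < b → k < a) → a ≡ b
≡-from-below a b a⊆b b⊆a = ≤-antisym (≮⇒≥ λ b<a → <-irrefl refl (a⊆b b b<a)) (≮⇒≥ λ a<b → <-irrefl refl (b⊆a a a<b))

product-zero : ∀ a b → (0 < a → 0 < b → ⊥) → a * b ≡ 0
product-zero zero    b       _   = refl
product-zero (suc a) zero    _   = *-zeroʳ (suc a)
product-zero (suc a) (suc b) pos = ⊥-elim (pos z<s z<s)

colLen-below : ∀ {j r} xs → j < r → colLen (r ∷ xs) j ≡ suc (colLen xs j)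
colLen-below {j} xs j<r = cong length (filter-accept (λ r → j <? r) j<r)

colLen-above : ∀ {j r} xs → r ≤ j → colLen (r ∷ xs) j ≡ colLen xs j
colLen-above {j} xs r≤j = cong length (filter-reject (λ r → j <? r) (≤⇒≯ r≤j))

colLen-empty : ∀ {p j} xs → All (_≤ p) xs → p ≤ j → colLen xs j ≡ 0
colLen-empty []       _           _   = refl
colLen-empty (x ∷ xs) (x≤p ∷ xs≤p) p≤j = trans (colLen-above xs (≤-trans x≤p p≤j)) (colLen-empty xs xs≤p p≤j)

colLen≤length : ∀ xs j → colLen xs j ≤ length xs
colLen≤length xs j = length-filter (λ r → j <? r) xs

hooksFrom-drop : ∀ r rest i rs → All (_≤ r) rs → hooksFrom (r ∷ rest) (suc i) rs ≡ hooksFrom rest i rs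
hooksFrom-drop r rest i []        _            = refl
hooksFrom-drop r rest i (r' ∷ rs) (r'≤r ∷ rs≤r) = cong₂ _++_ row (hooksFrom-drop r rest (suc i) rs rs≤r)
  where
  row : hooksRow (r ∷ rest) (suc i) r' ≡ hooksRow rest i r'
  row = map-upTo-cong r' _ _ (λ j j<r' →
    cong (λ c → (r' ∸ suc j) + (c ∸ suc (suc i)) + 1) (colLen-below rest (<-≤-trans j<r' r'≤r)))

hooks-cons : ∀ r rest → Linked _≥_ (r ∷ rest) → hooks (r ∷ rest) ≡ hooksRow (r ∷ rest) 0 r ++ hooks rest
hooks-cons r rest lk = cong (hooksRow (r ∷ rest) 0 r ++_) (hooksFrom-drop r rest 0 rest (head-bounds lk))

beta-bounded : ∀ p xs → All (_≤ p) xs → All (_< p + length xs) (beta xs)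
beta-bounded p []       _            = []
beta-bounded p (x ∷ xs) (x≤p ∷ xs≤p) =
  subst (x + length xs <_) (sym (+-suc p (length xs))) (s≤s (+-monoˡ-≤ (length xs) x≤p))
  ∷ All.map (λ q → <-trans q (subst (p + length xs <_) (sym (+-suc p (length xs))) (n<1+n _)))
            (beta-bounded p xs xs≤p)

column-gap-∉ : ∀ r rest → Linked _≥_ rest → All (_≤ r) rest → ∀ j y → j < r →
               y + colLen rest j ≡ j + length rest → y ∉ beta rest
column-gap-∉ r [] _ _ j y j<r eq ()
column-gap-∉ r (r' ∷ rs) lk (r'≤r ∷ _) j y j<r eq with j <? r'
... | yes j<r' = λ { (here y≡) → <⇒≢ y<head y≡
                   ; (there y∈) → column-gap-∉ r' rs (Linked.tail lk) (head-bounds lk) j y j<r' eq' y∈ }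
  where
  eq' : y + colLen rs j ≡ j + length rs
  eq' = suc-injective (begin
    suc (y + colLen rs j)     ≡⟨ +-suc y _ ⟨
    y + suc (colLen rs j)     ≡⟨ cong (y +_) (colLen-below rs j<r') ⟨
    y + colLen (r' ∷ rs) j    ≡⟨ eq ⟩
    j + suc (length rs)       ≡⟨ +-suc j _ ⟩
    suc (j + length rs)       ∎)
    where open ≡-Reasoning
  y<head : y < r' + length rs
  y<head = ≤-<-trans (m≤m+n y _) (subst (_< r' + length rs) (sym eq') (+-monoˡ-< (length rs) j<r'))
... | no j≮r' = λ { (here y≡) → <⇒≢ head<y (sym y≡)
                  ; (there y∈) → <-asym (All.lookup (beta-bounded r' rs (head-bounds lk)) y∈) head<y }
  where
  r'≤j = ≮⇒≥ j≮r'
  y≡ : y ≡ j + suc (length rs)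
  y≡ = trans (sym (+-identityʳ y))
         (trans (cong (y +_) (sym (trans (colLen-above rs r'≤j) (colLen-empty rs (head-bounds lk) r'≤j)))) eq)
  head<y : r' + length rs < y
  head<y = subst (r' + length rs <_) (sym (trans y≡ (+-suc j (length rs)))) (s≤s (+-monoˡ-≤ (length rs) r'≤j))

∉-column-gap : ∀ r rest → Linked _≥_ rest → All (_≤ r) rest → ∀ y → y < r + length rest → y ∉ beta rest →
               Σ ℕ λ j → j < r × y + colLen rest j ≡ j + length rest
∉-column-gap r [] _ _ y y< _ = y , subst (y <_) (+-identityʳ r) y< , refl
∉-column-gap r (r' ∷ rs) lk (r'≤r ∷ _) y y< y∉ with <-cmp y (r' + length rs)
... | tri≈ _ y≡ _ = ⊥-elim (y∉ (here y≡))
... | tri< y<head _ _ with ∉-column-gap r' rs (Linked.tail lk) (head-bounds lk) y y<head (y∉ ∘ there)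
...   | j , j<r' , eq = j , <-≤-trans j<r' r'≤r , (begin
  y + colLen (r' ∷ rs) j    ≡⟨ cong (y +_) (colLen-below rs j<r') ⟩
  y + suc (colLen rs j)     ≡⟨ +-suc y _ ⟩
  suc (y + colLen rs j)     ≡⟨ cong suc eq ⟩
  suc (j + length rs)       ≡⟨ +-suc j _ ⟨
  j + suc (length rs)       ∎)
  where open ≡-Reasoning
∉-column-gap r (r' ∷ rs) lk (r'≤r ∷ _) y y< y∉ | tri> _ _ head<y =
  j , j<r , trans (cong (y +_) column-empty) (trans (+-identityʳ y) (sym j+ℓ≡y))
  where
  ℓ = length rs
  j = y ∸ suc ℓ
  j+ℓ≡y : j + suc ℓ ≡ y
  j+ℓ≡y = m∸n+n≡m (<-≤-trans (s≤s (m≤n+m ℓ r')) head<y)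
  j<r : j < r
  j<r = +-cancelʳ-< (suc ℓ) j r (subst (_< r + suc ℓ) (sym j+ℓ≡y) y<)
  r'≤j : r' ≤ j
  r'≤j = +-cancelʳ-≤ (suc ℓ) r' j (subst₂ _≤_ (sym (+-suc r' ℓ)) (sym j+ℓ≡y) head<y)
  column-empty : colLen (r' ∷ rs) j ≡ 0
  column-empty = trans (colLen-above rs r'≤j) (colLen-empty rs (head-bounds lk) r'≤j)

-- The hook of box (1, j+1) plus the matching non-member y is the first β-number.
firstRow-hook : ∀ r rest j y → j < r → y + colLen rest j ≡ j + length rest →
  (r ∸ suc j) + (colLen (r ∷ rest) j ∸ 1) + 1 + y ≡ r + length rest
firstRow-hook r rest j y j<r eq = begin
  (r ∸ suc j) + (colLen (r ∷ rest) j ∸ 1) + 1 + y ≡⟨ cong (λ c → (r ∸ suc j) + (c ∸ 1) + 1 + y) (colLen-below rest j<r) ⟩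
  (r ∸ suc j) + colLen rest j + 1 + y             ≡⟨ rearrange (r ∸ suc j) (colLen rest j) y ⟩
  (r ∸ suc j) + 1 + (y + colLen rest j)           ≡⟨ cong ((r ∸ suc j) + 1 +_) eq ⟩
  (r ∸ suc j) + 1 + (j + length rest)             ≡⟨ regroup (r ∸ suc j) j (length rest) ⟩
  (r ∸ suc j) + suc j + length rest               ≡⟨ cong (_+ length rest) (m∸n+n≡m j<r) ⟩
  r + length rest                                 ∎
  where
  open ≡-Reasoning
  rearrange : ∀ a c y → a + c + 1 + y ≡ a + 1 + (y + c)
  rearrange = solve-∀
  regroup : ∀ a j l → a + 1 + (j + l) ≡ a + suc j + l
  regroup = solve-∀

hook⇒β-difference : ∀ la → Linked _≥_ la → ∀ {h} → h ∈ hooks la →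
  Σ ℕ λ x → Σ ℕ λ y → x ∈ beta la × y ∉ beta la × h + y ≡ x
hook⇒β-difference [] _ ()
hook⇒β-difference (r ∷ rest) lk {h} h∈
  with ∈-++⁻ (hooksRow (r ∷ rest) 0 r) (subst (h ∈_) (hooks-cons r rest lk) h∈)
... | inj₁ h∈row with ∈-map⁻ _ h∈row
...   | j , j∈ , refl = r + length rest , y , here refl , y∉ , firstRow-hook r rest j y j<r y-eq
  where
  j<r = ∈-upTo⁻ j∈
  y = (j + length rest) ∸ colLen rest j
  y-eq : y + colLen rest j ≡ j + length rest
  y-eq = m∸n+n≡m (≤-trans (colLen≤length rest j) (m≤n+m _ j))
  y∉ : y ∉ beta (r ∷ rest)
  y∉ (here y≡) = <⇒≢ (≤-<-trans (m∸n≤m _ (colLen rest j)) (+-monoˡ-< (length rest) j<r)) y≡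
  y∉ (there y∈) = column-gap-∉ r rest (Linked.tail lk) (head-bounds lk) j y j<r y-eq y∈
hook⇒β-difference (r ∷ rest) lk {h} h∈ | inj₂ h∈rest with hook⇒β-difference rest (Linked.tail lk) h∈rest
... | x , y , x∈ , y∉ , eq = x , y , there x∈ , y∉' , eq
  where
  y∉' : y ∉ beta (r ∷ rest)
  y∉' (here y≡) =
    <⇒≢ (≤-<-trans (subst (y ≤_) eq (m≤n+m y h)) (All.lookup (beta-bounded r rest (head-bounds lk)) x∈)) y≡
  y∉' (there y∈) = y∉ y∈

β-difference⇒hook : ∀ la → Linked _≥_ la → ∀ {x y} → x ∈ beta la → y ∉ beta la → y < x →
  Σ ℕ λ h → h ∈ hooks la × h + y ≡ x
β-difference⇒hook (r ∷ rest) lk {y = y} (here refl) y∉ y<x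
  with ∉-column-gap r rest (Linked.tail lk) (head-bounds lk) y y<x (y∉ ∘ there)
... | j , j<r , eq = hook , subst (hook ∈_) (sym (hooks-cons r rest lk)) (∈-++⁺ˡ hook∈row) , firstRow-hook r rest j y j<r eq
  where
  hookAt = λ j → (r ∸ suc j) + (colLen (r ∷ rest) j ∸ 1) + 1
  hook = hookAt j
  hook∈row : hook ∈ hooksRow (r ∷ rest) 0 r
  hook∈row = ∈-map⁺ hookAt (∈-upTo⁺ j<r)
β-difference⇒hook (r ∷ rest) lk (there x∈) y∉ y<x with β-difference⇒hook rest (Linked.tail lk) x∈ (y∉ ∘ there) y<x
... | h , h∈ , eq = h , subst (h ∈_) (sym (hooks-cons r rest lk)) (∈-++⁺ʳ _ h∈) , eq

Closed : ℕ → List ℕ → Set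
Closed s B = ∀ {x} → x ∈ B → s ≤ x → x ∸ s ∈ B

closed-descend : ∀ {s B} → Closed s B → ∀ q y → y + q * s ∈ B → y ∈ B
closed-descend {s} {B} cl zero y y∈ = subst (_∈ B) (+-identityʳ y) y∈
closed-descend {s} {B} cl (suc q) y x∈ = closed-descend cl q y (subst (_∈ B) x∸s≡ (cl x∈ s≤x))
  where
  x≡ : y + suc q * s ≡ (y + q * s) + s
  x≡ = trans (cong (y +_) (+-comm s (q * s))) (sym (+-assoc y (q * s) s))
  s≤x : s ≤ y + suc q * s
  s≤x = subst (s ≤_) (sym x≡) (m≤n+m s _)
  x∸s≡ : y + suc q * s ∸ s ≡ y + q * s
  x∸s≡ = trans (cong (_∸ s) x≡) (m+n∸n≡m _ s)

core⇒closed : ∀ s la → Linked _≥_ la → IsCore s la → Closed s (beta la)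
core⇒closed s la lk core {x} x∈ s≤x with x ∸ s ∈? beta la
  where open import Data.List.Membership.DecPropositional _≟_ using (_∈?_)
... | yes x∸s∈ = x∸s∈
... | no x∸s∉ with β-difference⇒hook la lk x∈ x∸s∉ (≤∧≢⇒< (m∸n≤m x s) (λ e → x∸s∉ (subst (_∈ beta la) (sym e) x∈)))
...   | h , h∈ , eq = ⊥-elim (All.lookup core h∈ (subst (s ∣_) (sym h≡s) ∣-refl))
  where
  h≡s : h ≡ s
  h≡s = +-cancelʳ-≡ (x ∸ s) h s (trans eq (trans (sym (m∸n+n≡m s≤x)) (+-comm (x ∸ s) s)))

closed⇒core : ∀ s la → Linked _≥_ la → Closed s (beta la) → IsCore s la
closed⇒core s la lk cl = All.tabulate no-multiple
  where
  no-multiple : ∀ {h} → h ∈ hooks la → ¬ (s ∣ h)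
  no-multiple h∈ (divides q refl) with hook⇒β-difference la lk h∈
  ... | x , y , x∈ , y∉ , eq = y∉ (closed-descend cl q y (subst (_∈ beta la) (trans (sym eq) (+-comm (q * s) y)) x∈))

Apart : ℕ → ℕ → Set
Apart a b = suc b < a

beta-apart : ∀ {la} → DistinctParts la → Linked Apart (beta la)
beta-apart [] = []
beta-apart [-] = [-]
beta-apart {r ∷ r' ∷ rs} (r>r' ∷ lk) = gap ∷ beta-apart lk
  where
  gap : suc (suc (r' + length rs)) ≤ r + suc (length rs)
  gap = subst (suc (suc (r' + length rs)) ≤_) (sym (+-suc r (length rs))) (s≤s (+-monoˡ-≤ (length rs) r>r'))

beta-positive : ∀ {la} → All (0 <_) la → 0 ∉ beta la
beta-positive {r ∷ rs} (r>0 ∷ _)   (here 0≡) = <⇒≢ (≤-trans r>0 (m≤m+n r _)) 0≡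
beta-positive          (_   ∷ rs>0) (there 0∈) = beta-positive rs>0 0∈

apart⇒decreasing : ∀ {L} → Linked Apart L → Linked _>_ L
apart⇒decreasing = Linked.map (λ gap → <-trans (n<1+n _) gap)

head-apart : ∀ {a L} → Linked Apart (a ∷ L) → All (Apart a) L
head-apart = AllPairs.head ∘ Linkedₚ.Linked⇒AllPairs {R = Apart} (λ p q → <-trans q (<-trans (n<1+n _) p))

apart⇒no-successor : ∀ {L x} → Linked Apart L → x ∈ L → suc x ∈ L → ⊥
apart⇒no-successor lk (here refl) (here x≡1+x) = <⇒≢ (n<1+n _) (sym x≡1+x)
apart⇒no-successor lk (here refl) (there sx∈) = <-asym (n<1+n _) (All.lookup (head-above (apart⇒decreasing lk)) sx∈)
apart⇒no-successor lk (there x∈)  (here refl) = <-irrefl refl (All.lookup (head-apart lk) x∈)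
apart⇒no-successor lk (there x∈)  (there sx∈) = apart⇒no-successor (Linked.tail lk) x∈ sx∈

no-successor⇒apart : ∀ {L} → Linked _>_ L → (∀ {x} → x ∈ L → suc x ∈ L → ⊥) → Linked Apart L
no-successor⇒apart [] _ = []
no-successor⇒apart [-] _ = [-]
no-successor⇒apart (a>b ∷ lk) no-succ =
  ≤∧≢⇒< a>b (λ e → no-succ (there (here refl)) (here e)) ∷ no-successor⇒apart lk (λ p q → no-succ (there p) (there q))

beta-injective : ∀ la mu → beta la ≡ beta mu → la ≡ mu
beta-injective []       []       _  = refl
beta-injective (r ∷ rs) (q ∷ qs) eq with ∷-injective eq
... | r+ℓ≡q+ℓ , tails with beta-injective rs qs tails
... | refl = cong (_∷ rs) (+-cancelʳ-≡ (length rs) r q r+ℓ≡q+ℓ)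

fromBeta : List ℕ → List ℕ
fromBeta []       = []
fromBeta (b ∷ bs) = (b ∸ length bs) ∷ fromBeta bs

length-fromBeta : ∀ B → length (fromBeta B) ≡ length B
length-fromBeta []       = refl
length-fromBeta (b ∷ bs) = cong suc (length-fromBeta bs)

length≤head : ∀ {b bs} → Linked _>_ (b ∷ bs) → length bs ≤ b
length≤head [-]         = z≤n
length≤head (b>b' ∷ lk) = ≤-trans (s≤s (length≤head lk)) b>b'

length<head : ∀ {b bs} → Linked _>_ (b ∷ bs) → 0 ∉ b ∷ bs → length bs < b
length<head {zero}  [-]         0∉ = ⊥-elim (0∉ (here refl))
length<head {suc b} [-]         _  = z<s
length<head         (b>b' ∷ lk) 0∉ = ≤-<-trans (length<head lk (0∉ ∘ there)) b>b'

beta-fromBeta : ∀ {B} → Linked _>_ B → beta (fromBeta B) ≡ B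
beta-fromBeta []             = refl
beta-fromBeta {b ∷ bs} lk = cong₂ _∷_
  (trans (cong ((b ∸ length bs) +_) (length-fromBeta bs)) (m∸n+n≡m (length≤head lk)))
  (beta-fromBeta (Linked.tail lk))

fromBeta-positive : ∀ {B} → Linked _>_ B → 0 ∉ B → All (0 <_) (fromBeta B)
fromBeta-positive []             _  = []
fromBeta-positive {b ∷ bs} lk 0∉ = m<n⇒0<n∸m (length<head lk 0∉) ∷ fromBeta-positive (Linked.tail lk) (0∉ ∘ there)

fromBeta-distinct : ∀ {B} → Linked Apart B → DistinctParts (fromBeta B)
fromBeta-distinct []  = []
fromBeta-distinct [-] = [-]
fromBeta-distinct {b ∷ b' ∷ bs} (gap ∷ lk) =
  subst (_≤ b ∸ suc (length bs)) (+-∸-assoc 1 (length≤head (apart⇒decreasing lk))) (∸-monoˡ-≤ (suc (length bs)) gap)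
  ∷ fromBeta-distinct lk

count : (t : ℕ) .{{_ : NonZero t}} → ℕ → List ℕ → ℕ
count t i B = length (filter (λ x → x % t ≟ i) B)

module _ (t : ℕ) .{{_ : NonZero t}} where

  residue-of : ∀ {i} k → i < t → (i + k * t) % t ≡ i
  residue-of {i} k i<t = trans ([m+kn]%n≡m%n i k t) (m<n⇒m%n≡m i<t)

  quotient-of : ∀ {i} k → i < t → (i + k * t) / t ≡ k
  quotient-of {i} k i<t = trans (+-distrib-/-∣ʳ i (divides k refl)) (cong₂ _+_ (m<n⇒m/n≡0 i<t) (m*n/n≡m k t))

  by-residue : ∀ x {i} → x % t ≡ i → x ≡ i + (x / t) * t
  by-residue x x%t≡i = trans (m≡m%n+[m/n]*n x t) (cong (_+ (x / t) * t) x%t≡i)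

  quotient-strict : ∀ {x y} → x % t ≡ y % t → x < y → x / t < y / t
  quotient-strict {x} {y} same x<y = ≰⇒> λ y/t≤x/t → <⇒≱ x<y (begin
    y                    ≡⟨ m≡m%n+[m/n]*n y t ⟩
    y % t + (y / t) * t  ≤⟨ +-mono-≤ (≤-reflexive (sym same)) (*-monoˡ-≤ t y/t≤x/t) ⟩
    x % t + (x / t) * t  ≡⟨ m≡m%n+[m/n]*n x t ⟨
    x                    ∎)
    where open ≤-Reasoning

  quotients-decreasing : ∀ {i C} → Linked _>_ C → All (λ x → x % t ≡ i) C → Linked _>_ (map (_/ t) C)
  quotients-decreasing []         _                = []
  quotients-decreasing [-]        _                = [-]
  quotients-decreasing (x>y ∷ lk) (x≡i ∷ y≡i ∷ rs) =
    quotient-strict (trans y≡i (sym x≡i)) x>y ∷ quotients-decreasing lk (y≡i ∷ rs)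

  quotients-downFrom : ∀ {B} → Linked _>_ B → Closed t B → ∀ i →
                       map (_/ t) (filter (λ x → x % t ≟ i) B) ≡ downFrom (count t i B)
  quotients-downFrom {B} lk cl i = trans class≡ (cong downFrom (length-map (_/ t) class))
    where
    inClass? = λ x → x % t ≟ i
    class = filter inClass? B
    class≡ : map (_/ t) class ≡ downFrom (length (map (_/ t) class))
    class≡ = predClosed⇒downFrom
      (quotients-decreasing (Linkedₚ.filter⁺ inClass? (λ p q → <-trans q p) lk)
                            (All.tabulate (λ x∈ → proj₂ (∈-filter⁻ inClass? {xs = B} x∈))))
      step
      where
      -- x ≡ i with x / t = k + 1 gives x - t ≡ i with quotient k
      step : ∀ {k} → suc k ∈ map (_/ t) class → k ∈ map (_/ t) class
      step {k} sk∈ with ∈-map⁻ (_/ t) sk∈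
      ... | x , x∈ , sk≡x/t = subst (_∈ map (_/ t) class) quotient≡ (∈-map⁺ (_/ t) x-t∈)
        where
        x∈B = proj₁ (∈-filter⁻ inClass? {xs = B} x∈)
        x≡i = proj₂ (∈-filter⁻ inClass? {xs = B} x∈)
        t≤x : t ≤ x
        t≤x = ≮⇒≥ λ x<t → 0≢1+n (trans (sym (m<n⇒m/n≡0 x<t)) (sym sk≡x/t))
        x-t∈ : x ∸ t ∈ class
        x-t∈ = ∈-filter⁺ inClass? (cl x∈B t≤x) (trans (m≤n⇒[n∸m]%m≡n%m t≤x) x≡i)
        quotient≡ : (x ∸ t) / t ≡ k
        quotient≡ = trans ([m∸n]/n≡m/n∸1 x t) (cong pred (sym sk≡x/t))

  member⇒below-count : ∀ {B} → Linked _>_ B → Closed t B → ∀ {i} k → i < t →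
                       i + k * t ∈ B → k < count t i B
  member⇒below-count {B} lk cl {i} k i<t i+kt∈ =
    ∈-downFrom⁻ (subst (k ∈_) (quotients-downFrom lk cl i)
      (subst (_∈ map (_/ t) (filter (λ x → x % t ≟ i) B)) (quotient-of k i<t)
        (∈-map⁺ (_/ t) (∈-filter⁺ (λ x → x % t ≟ i) i+kt∈ (residue-of k i<t)))))

  below-count⇒member : ∀ {B} → Linked _>_ B → Closed t B → ∀ {i} k →
                       k < count t i B → i + k * t ∈ B
  below-count⇒member {B} lk cl {i} k k<c
    with ∈-map⁻ (_/ t) (subst (k ∈_) (sym (quotients-downFrom lk cl i)) (∈-downFrom⁺ k<c))
  ... | x , x∈ , k≡x/t = subst (_∈ B) (trans (by-residue x x≡i) (cong (λ q → i + q * t) (sym k≡x/t))) x∈B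
    where
    x∈B = proj₁ (∈-filter⁻ (λ x → x % t ≟ i) {xs = B} x∈)
    x≡i = proj₂ (∈-filter⁻ (λ x → x % t ≟ i) {xs = B} x∈)

-- From here on t = t-2 + 2 ≥ 2 and m = m-1 + 1 ≥ 1; s = mt - 1 is the second core.
module CoreProfiles (t-2 m-1 : ℕ) where

  t m s : ℕ
  t = suc (suc t-2)
  m = suc m-1
  s = m * t ∸ 1

  -- Removing s = mt - 1 from i + mt leaves i + 1 (note mt = s + 1 and s = (t-1) + (m-1)t definitionally).
  remove-s : ∀ i → i + m * t ∸ s ≡ suc i
  remove-s i = trans (cong (_∸ s) (+-suc i s)) (m+n∸n≡m (suc i) s)

  s≤i+mt : ∀ i → s ≤ i + m * t
  s≤i+mt i = ≤-trans (n≤1+n s) (m≤n+m (m * t) i)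

  -- The β-sets of the partitions in S⁻_{m,t}.
  record Admissible (B : List ℕ) : Set where
    field
      apart    : Linked Apart B
      0∉       : 0 ∉ B
      t-closed : Closed t B
      s-closed : Closed s B

    decreasing : Linked _>_ B
    decreasing = apart⇒decreasing apart

  InS⇒admissible : ∀ {la} → InS m t la → Admissible (beta la)
  InS⇒admissible {la} ((pos , weakly) , distinct , t-core , s-core) = record
    { apart    = beta-apart distinct
    ; 0∉       = beta-positive pos
    ; t-closed = core⇒closed t la weakly t-core
    ; s-closed = core⇒closed s la weakly s-core
    }

  admissible⇒InS : ∀ {B} → Admissible B → InS m t (fromBeta B)
  admissible⇒InS {B} adm = (fromBeta-positive decreasing 0∉ , weakly) , distinct ,
    closed⇒core t (fromBeta B) weakly (subst (Closed t) (sym β≡) t-closed) ,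
    closed⇒core s (fromBeta B) weakly (subst (Closed s) (sym β≡) s-closed)
    where
    open Admissible adm
    β≡ = beta-fromBeta decreasing
    distinct = fromBeta-distinct apart
    weakly = Linked.map <⇒≤ distinct

  -- The count vector (n₁, …, n_{t-1}) of a set; φ(λ) is profile (β(λ)) by definition.
  profile : List ℕ → List ℕ
  profile B = map (λ i → count t (suc i) B) (upTo (t ∸ 1))

  profile-at : ∀ B k → k < t ∸ 1 → at (profile B) k ≡ count t (suc k) B
  profile-at B = at-map-upTo (λ i → count t (suc i) B) (t ∸ 1)

  module Counts {B : List ℕ} (adm : Admissible B) where
    open Admissible adm

    smallest-member : ∀ {i} → i < t → 0 < count t i B → i ∈ B
    smallest-member {i} i<t pos = subst (_∈ B) (+-identityʳ i) (below-count⇒member t decreasing t-closed 0 pos)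

    -- No member is divisible by t: removing t repeatedly would reach 0.
    nonzero-residue : ∀ {x} → x ∈ B → x % t ≢ 0
    nonzero-residue {x} x∈ x%t≡0 = 0∉ (closed-descend t-closed (x / t) 0 (subst (_∈ B) (by-residue t x x%t≡0) x∈))

    -- n_i ≤ m: otherwise i + mt ∈ B, and removing s = mt-1 gives i+1 ∈ B next to i.
    count-bounded : ∀ i → i < t → count t i B ≤ m
    count-bounded i i<t = ≮⇒≥ λ m<n → apart⇒no-successor apart
      (smallest-member i<t (≤-<-trans z≤n m<n))
      (subst (_∈ B) (remove-s i) (s-closed (below-count⇒member t decreasing t-closed m m<n) (s≤i+mt i)))

    -- n_i n_{i+1} = 0: otherwise both i and i+1 belong to B.
    neighbours-vanish : ∀ i → suc i < t → count t i B * count t (suc i) B ≡ 0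
    neighbours-vanish i i+1<t = product-zero _ _ λ n-pos n'-pos → apart⇒no-successor apart
      (smallest-member (<-trans (n<1+n i) i+1<t) n-pos) (smallest-member i+1<t n'-pos)

    -- n_{t-1} ≤ m-1: otherwise (t-1) + (m-1)t = s ∈ B, and removing s gives 0 ∈ B.
    last-count-bounded : count t (suc t-2) B ≤ m-1
    last-count-bounded = ≮⇒≥ λ m-1<n →
      0∉ (subst (_∈ B) (n∸n≡0 s) (s-closed (below-count⇒member t decreasing t-closed m-1 m-1<n) ≤-refl))

    profile-in-C : InC m t (profile B)
    profile-in-C = length-profile , bounded , vanish , last-bounded
      where
      length-profile : length (profile B) ≡ t ∸ 1
      length-profile = trans (length-map _ (upTo (t ∸ 1))) (length-upTo (t ∸ 1))
      k+2<t : ∀ {k} → k + 2 < t → suc (suc k) < t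
      k+2<t {k} = subst (_< t) (+-comm k 2)
      bounded : ∀ k → k + 2 < t → at (profile B) k ≤ m
      bounded k k+2< = subst (_≤ m) (sym (profile-at B k (≤-pred (<-trans (n<1+n _) (k+2<t k+2<)))))
                         (count-bounded (suc k) (<-trans (n<1+n _) (k+2<t k+2<)))
      vanish : ∀ k → k + 2 < t → at (profile B) k * at (profile B) (suc k) ≡ 0
      vanish k k+2< = subst₂ (λ a b → a * b ≡ 0)
        (sym (profile-at B k (<-trans (n<1+n _) (≤-pred (k+2<t k+2<))))) (sym (profile-at B (suc k) (≤-pred (k+2<t k+2<))))
        (neighbours-vanish (suc k) (k+2<t k+2<))
      last-bounded : at (profile B) (t ∸ 2) ≤ m ∸ 1
      last-bounded = subst (_≤ m-1) (sym (profile-at B t-2 (n<1+n t-2))) last-count-bounded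

  -- An admissible set is determined by its profile: a member x ≡ j+1 (mod t)
  -- is j+1 + (x/t)t with x/t < n_{j+1}, and the counts agree.
  profile-injective : ∀ {B B'} → Admissible B → Admissible B' → profile B ≡ profile B' → B ≡ B'
  profile-injective adm adm' same = decreasing-ext (decreasing adm) (decreasing adm') (transfer adm adm' same)
                                                   (transfer adm' adm (sym same))
    where
    open Admissible using (decreasing; t-closed)
    transfer : ∀ {B B'} → Admissible B → Admissible B' → profile B ≡ profile B' → ∀ {x} → x ∈ B → x ∈ B'
    transfer {B} {B'} adm adm' same {x} x∈ with x % t in x%t≡
    ... | zero  = ⊥-elim (Counts.nonzero-residue adm x∈ x%t≡)
    ... | suc j = subst (_∈ B') (sym x≡)
      (below-count⇒member t (decreasing adm') (t-closed adm') (x / t)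
        (subst (x / t <_) counts≡
          (member⇒below-count t (decreasing adm) (t-closed adm) (x / t) j+1<t (subst (_∈ B) x≡ x∈))))
      where
      x≡ = by-residue t x x%t≡
      j+1<t : suc j < t
      j+1<t = subst (_< t) x%t≡ (m%n<n x t)
      counts≡ : count t (suc j) B ≡ count t (suc j) B'
      counts≡ = trans (sym (profile-at B j (≤-pred j+1<t))) (trans (cong (λ l → at l j) same) (profile-at B' j (≤-pred j+1<t)))

  -- Every vector of C⁻_{m,t} is the profile of the admissible set
  -- { i + kt : 1 ≤ i < t, k < x_i }.
  module Realisation (xs : List ℕ) (xs∈C : InC m t xs) where

    Selected : ℕ → Set
    Selected x = 0 < x % t × x / t < at xs (pred (x % t))

    selected? : (x : ℕ) → Dec (Selected x)
    selected? x = (0 <? x % t) ×-dec (x / t <? at xs (pred (x % t)))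

    -- Searching below mt suffices, since x_i ≤ m.
    realised : List ℕ
    realised = filter selected? (downFrom (m * t))

    member⁻ : ∀ {x} → x ∈ realised → x < m * t × Selected x
    member⁻ x∈ = ∈-downFrom⁻ (proj₁ (∈-filter⁻ selected? {xs = downFrom (m * t)} x∈)) ,
                 proj₂ (∈-filter⁻ selected? {xs = downFrom (m * t)} x∈)

    member⁺ : ∀ {x} → x < m * t → Selected x → x ∈ realised
    member⁺ x<mt sel = ∈-filter⁺ selected? (∈-downFrom⁺ x<mt) sel

    bounded : ∀ j → j + 2 < t → at xs j ≤ m
    bounded = proj₁ (proj₂ xs∈C)

    vanish : ∀ j → j + 2 < t → at xs j * at xs (suc j) ≡ 0
    vanish = proj₁ (proj₂ (proj₂ xs∈C))

    last-bounded : at xs t-2 ≤ m-1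
    last-bounded = proj₂ (proj₂ (proj₂ xs∈C))

    j+2<t : ∀ {j} → j < t-2 → j + 2 < t
    j+2<t {j} j<t-2 = subst (_< t) (+-comm 2 j) (s<s (s<s j<t-2))

    entry-bounded : ∀ j → j < suc t-2 → at xs j ≤ m
    entry-bounded j j<t-1 with m≤n⇒m<n∨m≡n (≤-pred j<t-1)
    ... | inj₁ j<t-2 = bounded j (j+2<t j<t-2)
    ... | inj₂ refl  = ≤-trans last-bounded (n≤1+n m-1)

    decreasing : Linked _>_ realised
    decreasing = Linkedₚ.filter⁺ selected? (λ p q → <-trans q p) (Linkedₚ.applyDownFrom⁺₂ id (m * t) n<1+n)

    t-closed : Closed t realised
    t-closed {x} x∈ t≤x = member⁺ (≤-<-trans (m∸n≤m x t) x<mt)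
      (subst (0 <_) (sym residue≡) x-pos ,
       subst (λ r → (x ∸ t) / t < at xs (pred r)) (sym residue≡)
         (subst (_< at xs (pred (x % t))) (sym ([m∸n]/n≡m/n∸1 x t)) (≤-<-trans pred[n]≤n quotient<)))
      where
      x<mt = proj₁ (member⁻ x∈)
      x-pos = proj₁ (proj₂ (member⁻ x∈))
      quotient< = proj₂ (proj₂ (member⁻ x∈))
      residue≡ : (x ∸ t) % t ≡ x % t
      residue≡ = m≤n⇒[n∸m]%m≡n%m t≤x

    -- Every selected x = (j+1) + qt is below s = (t-1) + (m-1)t: either
    -- j+1 < t-1 and q ≤ m-1, or j+1 = t-1 and q < m-1.
    below-s : ∀ {x} → x ∈ realised → x < s
    below-s {x} x∈ with x % t in x%t≡ | proj₂ (member⁻ x∈)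
    ... | suc j | _ , q< with m≤n⇒m<n∨m≡n (≤-pred (≤-pred (subst (_< t) x%t≡ (m%n<n x t))))
    ...   | inj₁ j<t-2 = subst (_< s) (sym (by-residue t x x%t≡))
            (+-mono-<-≤ (s<s j<t-2) (*-monoˡ-≤ t (≤-pred (<-≤-trans q< (bounded j (j+2<t j<t-2))))))
    ...   | inj₂ refl  = subst (_< s) (sym (by-residue t x x%t≡)) (+-monoʳ-< (suc t-2) (*-monoˡ-< t (<-≤-trans q< last-bounded)))

    -- x and x+1 cannot both be selected: their residues would be consecutive
    -- classes with positive entries, or x+1 would be divisible by t.
    no-successor : ∀ {x} → x ∈ realised → suc x ∈ realised → ⊥
    no-successor {x} x∈ sx∈ with x % t in x%t≡ | proj₂ (member⁻ x∈) | proj₂ (member⁻ sx∈)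
    ... | suc j | _ , q< | sx-pos , q'< with suc (suc j) <? t
    ...   | yes j+2<t' = [ (λ x_j≡0 → <-irrefl (sym x_j≡0) (≤-<-trans z≤n q<)) ,
                           (λ x_j+1≡0 → <-irrefl (sym x_j+1≡0) (≤-<-trans z≤n q'<')) ]′
                         (m*n≡0⇒m≡0∨n≡0 (at xs j) (vanish j (subst (_< t) (+-comm 2 j) j+2<t')))
      where
      residue≡ : suc x % t ≡ suc (suc j)
      residue≡ = trans (cong (λ y → suc y % t) (by-residue t x x%t≡)) (residue-of t (x / t) j+2<t')
      q'<' : suc x / t < at xs (suc j)
      q'<' = subst (λ r → suc x / t < at xs (pred r)) residue≡ q'<
    ...   | no j+2≮t = <-irrefl (sym residue≡) sx-pos
      where
      residue≡ : suc x % t ≡ 0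
      residue≡ = trans (cong (λ y → suc y % t) (by-residue t x x%t≡))
                   (trans ([m+kn]%n≡m%n (suc (suc j)) (x / t) t)
                     (trans (cong (_% t) (≤∧≮⇒≡ (subst (_< t) x%t≡ (m%n<n x t)) j+2≮t)) (n%n≡0 t)))

    admissible : Admissible realised
    admissible = record
      { apart    = no-successor⇒apart decreasing no-successor
      ; 0∉       = λ 0∈ → <-irrefl refl (proj₁ (proj₂ (member⁻ 0∈)))
      ; t-closed = t-closed
      ; s-closed = λ x∈ s≤x → ⊥-elim (<⇒≱ (below-s x∈) s≤x)
      }

    -- n_{j+1} of the realised set is x_{j+1}: k < n_{j+1} iff (j+1) + kt is selected iff k < x_{j+1}.
    count-realised : ∀ j → j < suc t-2 → count t (suc j) realised ≡ at xs j
    count-realised j j<t-1 = ≡-from-below _ _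
      (λ k k<n → subst₂ (λ q r → q < at xs (pred r)) (quotient-of t k j+1<t) (residue-of t k j+1<t)
                   (proj₂ (proj₂ (member⁻ (below-count⇒member t decreasing t-closed k k<n)))))
      (λ k k<x → member⇒below-count t decreasing t-closed k j+1<t
                   (member⁺ (below-mt k k<x) (subst (0 <_) (sym (residue-of t k j+1<t)) z<s ,
                     subst₂ (λ q r → q < at xs (pred r)) (sym (quotient-of t k j+1<t)) (sym (residue-of t k j+1<t)) k<x)))
      where
      j+1<t = s<s j<t-1
      below-mt : ∀ k → k < at xs j → suc j + k * t < m * t
      below-mt k k<x = <-≤-trans (+-monoˡ-< (k * t) j+1<t) (*-monoˡ-≤ t (<-≤-trans k<x (entry-bounded j j<t-1)))

    profile-realised : profile realised ≡ xs
    profile-realised = map-upTo-at _ xs (suc t-2) (proj₁ xs∈C) count-realised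

theorem4p1 : (t m : ℕ) → 2 ≤ t → 1 ≤ m →
    ((la : List ℕ) → InS m t la → InC m t (phi t la))
    × ((la mu : List ℕ) → InS m t la → InS m t mu → phi t la ≡ phi t mu → la ≡ mu)
    × ((xs : List ℕ) → InC m t xs → Σ (List ℕ) (λ la → InS m t la × phi t la ≡ xs))
theorem4p1 (suc zero) _ (s≤s ()) _
theorem4p1 (suc (suc t-2)) (suc m-1) _ _ = maps-into , injective , surjective
  where
  open CoreProfiles t-2 m-1

  maps-into : ∀ la → InS m t la → InC m t (phi t la)
  maps-into la la∈S = Counts.profile-in-C (InS⇒admissible la∈S)

  injective : ∀ la mu → InS m t la → InS m t mu → phi t la ≡ phi t mu → la ≡ mu
  injective la mu la∈S mu∈S same =
    beta-injective la mu (profile-injective (InS⇒admissible la∈S) (InS⇒admissible mu∈S) same)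

  surjective : ∀ xs → InC m t xs → Σ (List ℕ) (λ la → InS m t la × phi t la ≡ xs)
  surjective xs xs∈C = fromBeta realised , admissible⇒InS admissible ,
    trans (cong profile (beta-fromBeta (Admissible.decreasing admissible))) profile-realised
    where open Realisation xs xs∈C
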